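{- Let $t$ be a positive integer, let $G$ be a graph with no induced subgraph isomorphic to the path $P_t$ on $t$ vertices, and let $Y$ be a Gyárfás decomposition of $G$. Then the height of $Y$ is at most $t-2$.
   Context: A Gyárfás decomposition of a connected graph $G$ is a rooted tree $Y$ such that: (1) the nodes of $Y$ (bags) are pairwise disjoint non-empty subsets of $V(G)$ whose union is $V(G)$; (2) the root bag consists of a single vertex; (3) if $u\in B$ and $u'\in B'$ are adjacent in $G$ for bags $B,B'$, then one of $B,B'$ is an ancestor of the other (every node is its own ancestor); (4) for every bag $B$, the subgraph induced by the union of $B$ and all its descendants is connected; (5) for every non-root bag $B$ there is a vertex $h(B)$ in the parent bag of $B$ adjacent to all vertices of $B$ and non-adjacent to all vertices in strict descendants of $B$. A Gyárfás decomposition of a disconnected graph is the union (a rooted forest) of Gyárfás decompositions of its connected components. The height of $Y$ is the maximum level of a bag, where the level of a bag is the number of edges on the path in $Y$ from it to a root bag. -}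

module Defs where

open import Data.Nat using (ℕ; zero; suc; _≤_)
open import Data.Fin using (Fin; toℕ)
open import Data.Maybe using (Maybe; just; nothing)
open import Data.Product using (Σ; ∃; _×_; _,_)
open import Data.Sum using (_⊎_)
open import Relation.Binary.PropositionalEquality using (_≡_; _≢_)
open import Relation.Nullary using (¬_)
open import Function.Definitions using (Injective)

record Graph : Set₁ where
  field
    n     : ℕ
    Adj   : Fin n → Fin n → Set
    sym   : ∀ {u v} → Adj u v → Adj v u
    irrefl : ∀ {u} → ¬ Adj u u

PathAdj : {t : ℕ} → Fin t → Fin t → Set
PathAdj i j = (suc (toℕ i) ≡ toℕ j) ⊎ (suc (toℕ j) ≡ toℕ i)

record InducedPath (G : Graph) (t : ℕ) : Set where
  open Graph G
  field
    f        : Fin t → Fin n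
    inj      : Injective _≡_ _≡_ f
    adj→path : ∀ i j → Adj (f i) (f j) → PathAdj i j
    path→adj : ∀ i j → PathAdj i j → Adj (f i) (f j)

PtFree : ℕ → Graph → Set
PtFree t G = ¬ InducedPath G t

module Forest {m : ℕ} (parent : Fin m → Maybe (Fin m)) where

  data Anc (a : Fin m) : Fin m → Set where
    here : Anc a a
    up   : ∀ {b p} → parent b ≡ just p → Anc a p → Anc a b

  data Level : Fin m → ℕ → Set where
    root : ∀ {b} → parent b ≡ nothing → Level b zero
    step : ∀ {b p k} → parent b ≡ just p → Level p k → Level b (suc k)

data WalkIn (G : Graph) (P : Fin (Graph.n G) → Set) :
     Fin (Graph.n G) → Fin (Graph.n G) → Set where
  nil  : ∀ {u} → P u → WalkIn G P u u
  cons : ∀ {u v w} → P u → Graph.Adj G u v → WalkIn G P v w → WalkIn G P u w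

-- Gyárfás decomposition of G (possibly disconnected: a rooted forest).
-- Bags are the fibres of  bag : V(G) → Fin m  (pairwise disjoint, covering),
-- nonempty by 'nonempty'.  The forest structure is given by 'parent';
-- 'acyclic' demands every node reach a root (so parent defines a forest).
record Gyarfas (G : Graph) : Set₁ where
  open Graph G
  field
    m        : ℕ
    bag      : Fin n → Fin m
    parent   : Fin m → Maybe (Fin m)
  open Forest parent public
  InStrictDesc : Fin m → Fin n → Set
  InStrictDesc B v = Anc B (bag v) × bag v ≢ B
  field
    acyclic  : ∀ b → ∃ λ k → Level b k
    nonempty : ∀ b → ∃ λ v → bag v ≡ b
    rootSingleton : ∀ b → parent b ≡ nothing →
                    ∃ λ v → (bag v ≡ b) × (∀ w → bag w ≡ b → w ≡ v)
    adjComparable : ∀ u v → Adj u v → Anc (bag u) (bag v) ⊎ Anc (bag v) (bag u)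
    descConnected : ∀ B u v → Anc B (bag u) → Anc B (bag v) →
                    WalkIn G (λ w → Anc B (bag w)) u v
    hub : ∀ B P → parent B ≡ just P →
          ∃ λ h → (bag h ≡ P)
                × (∀ v → bag v ≡ B → Adj h v)
                × (∀ v → InStrictDesc B v → ¬ Adj h v)

HeightAtMost : {G : Graph} → Gyarfas G → ℕ → Set
HeightAtMost Y k = ∀ b l → Gyarfas.Level Y b l → l ≤ k

{-# OPTIONS --safe #-}
-- Below a bag B at level l, pick a vertex w ∈ B and climb the forest: w, the hub h(B) in the
-- parent bag, the hub of the parent in the grandparent bag, …, up to the root vertex. These
-- l + 1 vertices lie in distinct bags, and consecutive ones are adjacent. They induce a path,
-- because each hub is non-adjacent to every vertex strictly below the bag it serves, and all
-- earlier vertices of the climb lie there. Hence P_t-freeness forces l + 1 < t.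
module Submission where

open import Defs
open import Data.Nat using (ℕ; zero; suc; _≤_; _∸_; z≤n; s≤s; _≤?_)
open import Data.Nat.Properties
  using (≤-reflexive; m≤n⇒m≤1+n; 1+n≰n; ∸-cancelˡ-≡; ∸-monoˡ-≤; ≰⇒>)
open import Data.Fin using (Fin; toℕ; inject≤)
open import Data.Fin.Properties using (toℕ-injective; toℕ-inject≤; toℕ≤pred[n])
open import Data.Maybe using (just)
open import Data.Product using (_,_)
open import Data.Sum using (_⊎_; inj₁; inj₂; swap)
open import Data.Empty using (⊥-elim)
open import Relation.Binary.PropositionalEquality using (_≡_; refl; sym; trans; cong; subst; subst₂)
open import Relation.Nullary using (¬_; yes; no)

-- PathAdj i j unfolds to Near (toℕ i) (toℕ j).
Near : ℕ → ℕ → Set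
Near i j = (suc i ≡ j) ⊎ (suc j ≡ i)

InducedPath-prefix : ∀ {G s t} → InducedPath G s → t ≤ s → InducedPath G t
InducedPath-prefix {s = s} {t} P t≤s = record
  { f        = λ i → f (↑ i)
  ; inj      = λ eq → toℕ-injective (index-eq (inj eq))
  ; adj→path = λ i j a → subst₂ Near (toℕ-inject≤ i t≤s) (toℕ-inject≤ j t≤s) (adj→path (↑ i) (↑ j) a)
  ; path→adj = λ i j p →
      path→adj (↑ i) (↑ j) (subst₂ Near (sym (toℕ-inject≤ i t≤s)) (sym (toℕ-inject≤ j t≤s)) p)
  }
  where
  open InducedPath P
  ↑ : Fin t → Fin s
  ↑ i = inject≤ i t≤s
  index-eq : ∀ {i j} → ↑ i ≡ ↑ j → toℕ i ≡ toℕ j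
  index-eq {i} {j} eq = trans (sym (toℕ-inject≤ i t≤s)) (trans (cong toℕ eq) (toℕ-inject≤ j t≤s))

module _ {G : Graph} (Y : Gyarfas G) where
  open Graph G renaming (sym to Adj-sym)
  open Gyarfas Y

  Level-unique : ∀ {b k l} → Level b k → Level b l → k ≡ l
  Level-unique (root _)   (root _)     = refl
  Level-unique (root e)   (step e′ _)  with () ← trans (sym e) e′
  Level-unique (step e _) (root e′)    with () ← trans (sym e) e′
  Level-unique (step e l) (step e′ l′) with refl ← trans (sym e) e′ = cong suc (Level-unique l l′)

  Anc-parent : ∀ {c b x} → parent c ≡ just b → Anc c x → Anc b x
  Anc-parent e here      = up e here
  Anc-parent e (up e′ a) = up e′ (Anc-parent e a)

  Anc⇒Level-≤ : ∀ {a x k l} → Anc a x → Level a k → Level x l → k ≤ l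
  Anc⇒Level-≤ here      la lx         = ≤-reflexive (Level-unique la lx)
  Anc⇒Level-≤ (up e a)  la (root e′)  with () ← trans (sym e) e′
  Anc⇒Level-≤ (up e a)  la (step e′ lp) with refl ← trans (sym e) e′ =
    m≤n⇒m≤1+n (Anc⇒Level-≤ a la lp)

  InStrictDesc-parent : ∀ {c b u} → parent c ≡ just b → Anc c (bag u) → InStrictDesc b u
  InStrictDesc-parent {b = b} e a with _ , lb ← acyclic b =
    Anc-parent e a , λ { refl → 1+n≰n (Anc⇒Level-≤ a (step e lb) lb) }

  -- An induced path g 0, …, g k climbing from w (indices beyond k are junk); `away` is what
  -- keeps it induced when a vertex from a child bag of bag w is prepended.
  record HubChain (w : Fin n) (k : ℕ) : Set where
    field
      g        : ℕ → Fin n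
      g0       : g 0 ≡ w
      adj⇒near : ∀ {i j} → i ≤ k → j ≤ k → Adj (g i) (g j) → Near i j
      near⇒adj : ∀ {i j} → i ≤ k → j ≤ k → Near i j → Adj (g i) (g j)
      level    : ∀ {i} → i ≤ k → Level (bag (g i)) (k ∸ i)
      away     : ∀ {i} → 1 ≤ i → i ≤ k → ∀ u → InStrictDesc (bag w) u → ¬ Adj (g i) u

  HubChain-root : ∀ {w} → Level (bag w) 0 → HubChain w 0
  HubChain-root {w} lw = record
    { g        = λ _ → w
    ; g0       = refl
    ; adj⇒near = λ { z≤n z≤n a → ⊥-elim (irrefl a) }
    ; near⇒adj = λ { z≤n z≤n (inj₁ ()) ; z≤n z≤n (inj₂ ()) }
    ; level    = λ { z≤n → lw }
    ; away     = λ { (s≤s _) () }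
    }

  HubChain-extend : ∀ {w h k} → HubChain h k → parent (bag w) ≡ just (bag h) → Adj h w →
                    (∀ u → InStrictDesc (bag w) u → ¬ Adj h u) → HubChain w (suc k)
  HubChain-extend {w} {h} {k} C e hw h-away = record
    { g = g ; g0 = refl ; adj⇒near = adj⇒near′ ; near⇒adj = near⇒adj′ ; level = level′ ; away = away′ }
    where
    open HubChain C renaming (g to gₕ; g0 to gₕ0)
    g : ℕ → Fin n
    g zero    = w
    g (suc i) = gₕ i

    w-below-h : InStrictDesc (bag h) w
    w-below-h = InStrictDesc-parent e here

    adj-from-w : ∀ {j} → j ≤ suc k → Adj w (g j) → Near 0 j
    adj-from-w {zero}        _       a = ⊥-elim (irrefl a)
    adj-from-w {suc zero}    _       _ = inj₁ refl
    adj-from-w {suc (suc j)} (s≤s q) a = ⊥-elim (away (s≤s z≤n) q w w-below-h (Adj-sym a))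

    adj⇒near′ : ∀ {i j} → i ≤ suc k → j ≤ suc k → Adj (g i) (g j) → Near i j
    adj⇒near′ {zero}          _       q       a = adj-from-w q a
    adj⇒near′ {suc i} {zero}  p       _       a = swap (adj-from-w p (Adj-sym a))
    adj⇒near′ {suc i} {suc j} (s≤s p) (s≤s q) a with adj⇒near p q a
    ... | inj₁ x = inj₁ (cong suc x)
    ... | inj₂ x = inj₂ (cong suc x)

    near⇒adj′ : ∀ {i j} → i ≤ suc k → j ≤ suc k → Near i j → Adj (g i) (g j)
    near⇒adj′ {zero}           _       _       (inj₁ refl) = subst (Adj w) (sym gₕ0) (Adj-sym hw)
    near⇒adj′ {suc _}          (s≤s p) (s≤s q) (inj₁ refl) = near⇒adj p q (inj₁ refl)
    near⇒adj′ {j = zero}       _       _       (inj₂ refl) = subst (λ x → Adj x w) (sym gₕ0) hw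
    near⇒adj′ {j = suc _}      (s≤s p) (s≤s q) (inj₂ refl) = near⇒adj p q (inj₂ refl)

    level′ : ∀ {i} → i ≤ suc k → Level (bag (g i)) (suc k ∸ i)
    level′ {zero}  _       = step e (subst (λ x → Level (bag x) k) gₕ0 (level z≤n))
    level′ {suc i} (s≤s p) = level p

    away′ : ∀ {i} → 1 ≤ i → i ≤ suc k → ∀ u → InStrictDesc (bag w) u → ¬ Adj (g i) u
    away′ {suc zero}    _ _       u below a = h-away u below (subst (λ x → Adj x u) gₕ0 a)
    away′ {suc (suc i)} _ (s≤s q) u (below , _) =
      away (s≤s z≤n) q u (InStrictDesc-parent e below)

  hubChain : ∀ {w k} → Level (bag w) k → HubChain w k
  hubChain lw@(root _) = HubChain-root lw
  hubChain {w} (step e lp) with hub (bag w) _ e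
  ... | h , refl , h-adj , h-away = HubChain-extend (hubChain lp) e (h-adj w refl) h-away

  HubChain⇒InducedPath : ∀ {w k} → HubChain w k → InducedPath G (suc k)
  HubChain⇒InducedPath {k = k} C = record
    { f        = λ i → g (toℕ i)
    ; inj      = λ {i} {j} eq → toℕ-injective (∸-cancelˡ-≡ (≤k i) (≤k j) (level-eq i j eq))
    ; adj→path = λ i j → adj⇒near (≤k i) (≤k j)
    ; path→adj = λ i j → near⇒adj (≤k i) (≤k j)
    }
    where
    open HubChain C
    ≤k : (i : Fin (suc k)) → toℕ i ≤ k
    ≤k = toℕ≤pred[n]
    level-eq : ∀ i j → g (toℕ i) ≡ g (toℕ j) → k ∸ toℕ i ≡ k ∸ toℕ j
    level-eq i j eq = Level-unique (level (≤k i)) (subst (λ x → Level (bag x) _) (sym eq) (level (≤k j)))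

  Level⇒InducedPath : ∀ {b l} → Level b l → InducedPath G (suc l)
  Level⇒InducedPath {b} lb with w , refl ← nonempty b = HubChain⇒InducedPath (hubChain lb)

lemma3p3 : (t : ℕ) → 1 ≤ t → (G : Graph) → PtFree t G →
    (Y : Gyarfas G) → HeightAtMost Y (t ∸ 2)
lemma3p3 t _ G free Y b l lb with t ≤? suc l
... | yes t≤1+l = ⊥-elim (free (InducedPath-prefix (Level⇒InducedPath Y lb) t≤1+l))
... | no  t≰1+l = ∸-monoˡ-≤ 2 (≰⇒> t≰1+l)
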